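{- Let $S$ be a sorting sequence of length $p$ with $r>1$ distinct values and multiplicities $p_1,\dots,p_r$, let $c=\gcd(p_1,\dots,p_r)$, and let $k\ge (4p-2p_1-2p_r)/c+1-r$. If there exists a general solution for $S$ with $f$ fake coins and a general solution for the reverse sequence $S'$ with $pk-f$ fake coins, then there exist a general solution for $S$ with $f$ fake coins satisfying the height bound for $k$ and a general solution for $S'$ with $pk-f$ fake coins satisfying the height bound for $k$.
   Context: A sorting sequence of length $p$ is a non-decreasing sequence of $p$ non-negative integers beginning with $0$ in which each entry equals the previous one or exceeds it by $1$ (it records the outcome of sorting $p$ piles of $k$ coins by weight, fake coins being lighter). If its distinct entries are $0,\dots,r-1$, let $p_i\ge1$ be the number of entries equal to $i-1$, so $\sum p_i=p$. A general solution with $f$ fake coins is an integer tuple $(f_1,\dots,f_r)$ with $0\le f_1<\dots<f_r$ and $\sum_i p_if_i=f$; it satisfies the height bound for $k$ if $f_r\le k$. The reverse sequence $S'$ is the sorting sequence of length $p$ with $r$ distinct values in which the number of entries equal to $i-1$ is $p_{r-i+1}$. -}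

module Defs where

open import Data.Nat using (ℕ; zero; suc; _+_; _*_; _≤_; _<_)
open import Data.Nat.GCD using (gcd)
open import Data.Fin using (Fin; _<_; fromℕ; opposite)
open import Data.Vec.Functional using (foldr)
open import Data.Product using (_×_)
open import Relation.Binary.PropositionalEquality using (_≡_)

-- A sorting sequence with r distinct values 0,…,r-1 is uniquely determined by
-- its multiplicity vector (p₁,…,p_r), pᵢ ≥ 1 = number of entries equal to i-1.
-- We represent it by that vector (index i : Fin r stands for p_{i+1}).
Mult : ℕ → Set
Mult r = Fin r → ℕ

IsSortingSeq : ∀ {r} → Mult r → Set
IsSortingSeq {r} m = (i : Fin r) → 1 ≤ m i


len : ∀ {r} → Mult r → ℕ
len m = foldr _+_ 0 m

gcdAll : ∀ {r} → Mult r → ℕ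
gcdAll m = foldr gcd 0 m

reverseSeq : ∀ {r} → Mult r → Mult r
reverseSeq m i = m (opposite i)

-- general solution (f₁,…,f_r) for S with f fake coins:
-- 0 ≤ f₁ < … < f_r (nonnegativity automatic in ℕ) and Σ pᵢ fᵢ = f
GeneralSolution : ∀ {r} → Mult r → ℕ → (Fin r → ℕ) → Set
GeneralSolution m f fs =
  ((i j : Fin _) → i Data.Fin.< j → fs i Data.Nat.< fs j)
  × foldr _+_ 0 (λ i → m i * fs i) ≡ f

HeightBound : ∀ {n} → ℕ → (Fin (suc n) → ℕ) → Set
HeightBound {n} k fs = fs (fromℕ n) ≤ k

-- An increasing tuple f₁ < … < f_r is the staircase (0,1,…,r−1) plus its gaps, and a unit of gap
-- in front of index j adds the tail sum T_j = p_j + … + p_r to the number of fake coins.  So a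
-- general solution for S is a list of parts T_j, and the bound f_r ≤ k says that the list has at
-- most K = k − (r−1) parts.  Likewise for S′, whose tail sums are the head sums H_j = p₁ + … + p_j
-- of S.  The two staircases contribute p(r−1), so the two part lists together weigh pK.
--
-- All parts are multiples of c, so among P = p/c parts some nonempty block sums to a multiple of p
-- (pigeonhole on prefix sums); replacing such blocks by copies of the part T₁ = p, each list
-- becomes q copies of p plus fewer than P parts smaller than p.  If both lists still had more
-- than K parts, counting would give 2P ≥ K + 4, which the bound on k excludes.  If the list for S′
-- is the short one, the complements p − H_j = T_{j+1} of its small parts, padded with copies of
-- p, form a short list for S.  Finally f′_i = k − f_{r+1−i} turns a height-bounded solution for S
-- into one for S′.
module Submission where

open import Defs
open import Data.Nat using (ℕ; zero; suc; _+_; _*_; _∸_; _≤_; _<_; _≥_; z≤n; s≤s; z<s; NonZero; >-nonZero; _≤?_; _<?_; _%_)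
open import Data.Nat.Properties
open import Data.Nat.DivMod using (m≡m%n+[m/n]*n; m%n<n; _/_; m/n*n≡m; m≥n⇒m/n>0)
open import Data.Nat.Divisibility using (_∣_; divides; ∣-trans; ∣m∣n⇒∣m+n; ∣⇒≤)
open import Data.Nat.GCD using (gcd[m,n]∣m; gcd[m,n]∣n; gcd[m,n]≡0⇒m≡0)
open import Data.Nat.Induction using (<-wellFounded)
open import Data.Nat.Tactic.RingSolver using (solve-∀)
open import Data.Fin as F using (Fin; zero; suc; toℕ; fromℕ; fromℕ<; inject₁; opposite)
import Data.Fin.Properties as FinP
open import Data.Fin.Permutation using (reverse)
open import Data.Vec.Functional using (tail; init; last)
open import Data.List using (List; []; _∷_; _++_; length; replicate; map; take; drop)
open import Data.List.Properties using (length-++; length-replicate; length-take; length-drop; take++drop≡id; take-[])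
open import Data.List.Relation.Unary.All using (All; []; _∷_)
open import Data.Product using (Σ; ∃-syntax; _×_; _,_)
open import Data.Sum using (_⊎_; inj₁; inj₂)
open import Data.Empty using (⊥-elim)
open import Function using (_∘_)
open import Induction.WellFounded using (Acc; acc)
open import Relation.Nullary using (yes; no)
open import Relation.Binary.PropositionalEquality
open import Algebra.Properties.CommutativeSemigroup +-commutativeSemigroup using (interchange; x∙yz≈y∙xz; xy∙z≈xz∙y)
open import Algebra.Properties.Semiring.Sum +-*-semiring
  using (sum; sum-cong-≗; ∑-distrib-+; sum-init-last; sum-permute; *-distribʳ-sum)

Increasing : ∀ {r} → (Fin r → ℕ) → Set
Increasing x = ∀ i j → i F.< j → x i < x j

sum-reverse : ∀ {r} (f : Fin r → ℕ) → sum (f ∘ opposite) ≡ sum f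
sum-reverse f = sym (sum-permute f reverse)

sum-∣ : ∀ {r} (f : Fin r → ℕ) {c} → (∀ i → c ∣ f i) → c ∣ sum f
sum-∣ {zero} f h = divides 0 refl
sum-∣ {suc r} f h = ∣m∣n⇒∣m+n (h zero) (sum-∣ (tail f) (h ∘ suc))

sum-≥ : ∀ {r} (f : Fin r → ℕ) {c} → (∀ i → c ≤ f i) → r * c ≤ sum f
sum-≥ {zero} f h = z≤n
sum-≥ {suc r} f h = +-mono-≤ (h zero) (sum-≥ (tail f) (h ∘ suc))

sum-*-+ : ∀ {r} (m y : Fin r → ℕ) a → sum (λ i → m i * (a + y i)) ≡ sum m * a + sum (λ i → m i * y i)
sum-*-+ m y a = begin
  sum (λ i → m i * (a + y i))                 ≡⟨ sum-cong-≗ (λ i → *-distribˡ-+ (m i) a (y i)) ⟩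
  sum (λ i → m i * a + m i * y i)             ≡⟨ ∑-distrib-+ (λ i → m i * a) (λ i → m i * y i) ⟩
  sum (λ i → m i * a) + sum (λ i → m i * y i) ≡⟨ cong (_+ _) (*-distribʳ-sum a m) ⟨
  sum m * a + sum (λ i → m i * y i)           ∎
  where open ≡-Reasoning

tailSum : ∀ {r} → (Fin r → ℕ) → Fin r → ℕ
tailSum m zero = sum m
tailSum m (suc j) = tailSum (tail m) j

tailSum-≤ : ∀ {r} (m : Fin r → ℕ) j → tailSum m j ≤ sum m
tailSum-≤ m zero = ≤-refl
tailSum-≤ m (suc j) = ≤-trans (tailSum-≤ (tail m) j) (m≤n+m _ (m zero))

tailSum-∣ : ∀ {r} (m : Fin r → ℕ) {c} → (∀ i → c ∣ m i) → ∀ j → c ∣ tailSum m j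
tailSum-∣ m h zero = sum-∣ m h
tailSum-∣ m h (suc j) = tailSum-∣ (tail m) (h ∘ suc) j

tailSum-inject₁ : ∀ {n} (m : Fin (suc n) → ℕ) j → tailSum m (inject₁ j) ≡ tailSum (init m) j + last m
tailSum-inject₁ m zero = sum-init-last m
tailSum-inject₁ m (suc j) = tailSum-inject₁ (tail m) j

tailSum-last : ∀ {n} (m : Fin (suc n) → ℕ) → tailSum m (fromℕ n) ≡ last m
tailSum-last {zero} m = +-identityʳ (m zero)
tailSum-last {suc n} m = tailSum-last (tail m)

-- A tail sum of the reversed sequence is a head sum of m, so unless it is all of p its
-- complement is a tail sum of m.
tailSum-reverse : ∀ {n} (m : Fin (suc n) → ℕ) j →
  tailSum (reverseSeq m) j ≡ sum m ⊎ ∃[ i ] tailSum m i + tailSum (reverseSeq m) j ≡ sum m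
tailSum-reverse m zero = inj₁ (sum-reverse m)
tailSum-reverse {suc n} m (suc j) with tailSum-reverse (init m) j
... | inj₁ whole = inj₂ (fromℕ (suc n) , trans (cong₂ _+_ (tailSum-last m) whole) (trans (+-comm (last m) _) (sym (sum-init-last m))))
... | inj₂ (i , e) = inj₂ (inject₁ i , (begin
  tailSum m (inject₁ i) + t                 ≡⟨ cong (_+ t) (tailSum-inject₁ m i) ⟩
  tailSum (init m) i + last m + t           ≡⟨ xy∙z≈xz∙y (tailSum (init m) i) (last m) t ⟩
  tailSum (init m) i + t + last m           ≡⟨ cong (_+ last m) e ⟩
  sum (init m) + last m                     ≡⟨ sum-init-last m ⟨
  sum m                                     ∎))
  where
  open ≡-Reasoning
  t = tailSum (reverseSeq (init m)) j

staircase : ∀ {r} → (Fin r → ℕ) → ℕ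
staircase m = sum (λ i → m i * toℕ i)

staircase-suc : ∀ {r} (m : Fin (suc r) → ℕ) → staircase m ≡ sum (tail m) + staircase (tail m)
staircase-suc m = begin
  m zero * 0 + sum (λ i → m (suc i) * suc (toℕ i)) ≡⟨ cong (_+ sum (λ i → m (suc i) * suc (toℕ i))) (*-zeroʳ (m zero)) ⟩
  sum (λ i → m (suc i) * (1 + toℕ i))             ≡⟨ sum-*-+ (tail m) (toℕ) 1 ⟩
  sum (tail m) * 1 + staircase (tail m)           ≡⟨ cong (_+ staircase (tail m)) (*-identityʳ (sum (tail m))) ⟩
  sum (tail m) + staircase (tail m)               ∎
  where open ≡-Reasoning

staircase-reverse : ∀ {n} (m : Fin (suc n) → ℕ) → staircase m + staircase (reverseSeq m) ≡ sum m * n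
staircase-reverse {n} m = begin
  staircase m + staircase (reverseSeq m)                         ≡⟨ cong (staircase m +_) reindex ⟩
  sum (λ i → m i * toℕ i) + sum (λ i → m i * toℕ (opposite i))   ≡⟨ ∑-distrib-+ (λ i → m i * toℕ i) (λ i → m i * toℕ (opposite i)) ⟨
  sum (λ i → m i * toℕ i + m i * toℕ (opposite i))               ≡⟨ sum-cong-≗ (λ i → trans (sym (*-distribˡ-+ (m i) (toℕ i) (toℕ (opposite i)))) (cong (m i *_) (toℕ+opposite i))) ⟩
  sum (λ i → m i * n)                                            ≡⟨ *-distribʳ-sum n m ⟨
  sum m * n                                                      ∎
  where
  open ≡-Reasoning
  toℕ+opposite : ∀ i → toℕ i + toℕ (opposite i) ≡ n
  toℕ+opposite i = trans (cong (toℕ i +_) (FinP.opposite-prop i)) (m+[n∸m]≡n (FinP.toℕ≤pred[n] i))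
  reindex : staircase (reverseSeq m) ≡ sum (λ i → m i * toℕ (opposite i))
  reindex = trans (sum-cong-≗ (λ i → cong (λ j → m (opposite i) * toℕ j) (sym (FinP.opposite-involutive i))))
                  (sum-reverse (λ i → m i * toℕ (opposite i)))

staircase-positive : ∀ {n} (m : Mult (suc (suc n))) → IsSortingSeq m → 0 < staircase m
staircase-positive m valid rewrite staircase-suc m = ≤-trans (valid (suc zero)) (≤-trans (m≤m+n _ _) (m≤m+n _ _))

-- Increasing tuples as lists of parts

weight : {A : Set} → (A → ℕ) → List A → ℕ
weight w [] = 0
weight w (x ∷ xs) = w x + weight w xs

weight-++ : {A : Set} (w : A → ℕ) (xs ys : List A) → weight w (xs ++ ys) ≡ weight w xs + weight w ys
weight-++ w [] ys = refl
weight-++ w (x ∷ xs) ys = trans (cong (w x +_) (weight-++ w xs ys)) (sym (+-assoc (w x) _ _))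

weight-* : {A : Set} (w g : A → ℕ) (c : ℕ) → (∀ x → w x ≡ g x * c) → ∀ xs → weight w xs ≡ weight g xs * c
weight-* w g c w≡gc [] = refl
weight-* w g c w≡gc (x ∷ xs) = trans (cong₂ _+_ (w≡gc x) (weight-* w g c w≡gc xs)) (sym (*-distribʳ-+ c (g x) _))

weight-replicate : {A : Set} (w : A → ℕ) (n : ℕ) (x : A) → weight w (replicate n x) ≡ n * w x
weight-replicate w zero x = refl
weight-replicate w (suc n) x = cong (w x +_) (weight-replicate w n x)

zeros : ∀ {r} → List (Fin (suc r)) → ℕ
zeros [] = 0
zeros (zero ∷ L) = suc (zeros L)
zeros (suc _ ∷ L) = zeros L

nonZeroPreds : ∀ {r} → List (Fin (suc r)) → List (Fin r)
nonZeroPreds [] = []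
nonZeroPreds (zero ∷ L) = nonZeroPreds L
nonZeroPreds (suc j ∷ L) = j ∷ nonZeroPreds L

-- Each occurrence of j in L raises the entries from index j on by one, on top of the staircase
-- (0, 1, …, r − 1).
fromParts : ∀ {r} → List (Fin r) → Fin r → ℕ
fromParts L zero = zeros L
fromParts L (suc i) = zeros L + suc (fromParts (nonZeroPreds L) i)

length-zeros : ∀ {r} (L : List (Fin (suc r))) → length L ≡ zeros L + length (nonZeroPreds L)
length-zeros [] = refl
length-zeros (zero ∷ L) = cong suc (length-zeros L)
length-zeros (suc j ∷ L) = trans (cong suc (length-zeros L)) (sym (+-suc _ _))

weight-tailSum : ∀ {r} (m : Fin (suc r) → ℕ) (L : List (Fin (suc r))) →
  weight (tailSum m) L ≡ zeros L * sum m + weight (tailSum (tail m)) (nonZeroPreds L)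
weight-tailSum m [] = refl
weight-tailSum m (zero ∷ L) = trans (cong (sum m +_) (weight-tailSum m L)) (sym (+-assoc (sum m) _ _))
weight-tailSum m (suc j ∷ L) = trans (cong (tailSum (tail m) j +_) (weight-tailSum m L))
  (x∙yz≈y∙xz (tailSum (tail m) j) (zeros L * sum m) (weight (tailSum (tail m)) (nonZeroPreds L)))

zeros-replicate : ∀ {r} a (L : List (Fin r)) → zeros (replicate a zero ++ map suc L) ≡ a
zeros-replicate (suc a) L = cong suc (zeros-replicate a L)
zeros-replicate zero [] = refl
zeros-replicate zero (j ∷ L) = zeros-replicate zero L

nonZeroPreds-replicate : ∀ {r} a (L : List (Fin r)) → nonZeroPreds (replicate a zero ++ map suc L) ≡ L
nonZeroPreds-replicate (suc a) L = nonZeroPreds-replicate a L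
nonZeroPreds-replicate zero [] = refl
nonZeroPreds-replicate zero (j ∷ L) = cong (j ∷_) (nonZeroPreds-replicate zero L)

fromParts-increasing : ∀ {r} (L : List (Fin r)) → Increasing (fromParts L)
fromParts-increasing L zero (suc j) _ = m<m+n (zeros L) z<s
fromParts-increasing L (suc i) (suc j) (s≤s i<j) =
  +-monoʳ-< (zeros L) (s≤s (fromParts-increasing (nonZeroPreds L) i j i<j))

fromParts-last : ∀ {n} (L : List (Fin (suc n))) → fromParts L (fromℕ n) ≡ n + length L
fromParts-last {zero} L = sym (trans (length-zeros L) (trans (cong (zeros L +_) (no-parts (nonZeroPreds L))) (+-identityʳ _)))
  where
  no-parts : (L′ : List (Fin 0)) → length L′ ≡ 0
  no-parts [] = refl
fromParts-last {suc n} L = begin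
  zeros L + suc (fromParts (nonZeroPreds L) (fromℕ n)) ≡⟨ cong (λ t → zeros L + suc t) (fromParts-last (nonZeroPreds L)) ⟩
  zeros L + suc (n + length (nonZeroPreds L))          ≡⟨ x+[1+y+z]≡1+y+[x+z] (zeros L) n _ ⟩
  suc n + (zeros L + length (nonZeroPreds L))          ≡⟨ cong (suc n +_) (length-zeros L) ⟨
  suc n + length L                                     ∎
  where
  open ≡-Reasoning
  x+[1+y+z]≡1+y+[x+z] : ∀ x y z → x + suc (y + z) ≡ suc y + (x + z)
  x+[1+y+z]≡1+y+[x+z] = solve-∀

sum-fromParts : ∀ {r} (m : Fin r → ℕ) (L : List (Fin r)) →
  sum (λ i → m i * fromParts L i) ≡ staircase m + weight (tailSum m) L
sum-fromParts {zero} m [] = refl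
sum-fromParts {suc r} m L = begin
  m zero * z + sum (λ i → m (suc i) * (z + suc (y i)))
    ≡⟨ cong (m zero * z +_) (sum-*-+ (tail m) (suc ∘ y) z) ⟩
  m zero * z + (s * z + sum (λ i → m (suc i) * (1 + y i)))
    ≡⟨ cong (λ t → m zero * z + (s * z + t)) (sum-*-+ (tail m) y 1) ⟩
  m zero * z + (s * z + (s * 1 + sum (λ i → m (suc i) * y i)))
    ≡⟨ cong (λ t → m zero * z + (s * z + (s * 1 + t))) (sum-fromParts (tail m) L′) ⟩
  m zero * z + (s * z + (s * 1 + (staircase (tail m) + weight (tailSum (tail m)) L′)))
    ≡⟨ regroup (m zero) z s (staircase (tail m)) _ ⟩
  (s + staircase (tail m)) + (z * (m zero + s) + weight (tailSum (tail m)) L′)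
    ≡⟨ cong₂ _+_ (staircase-suc m) (weight-tailSum m L) ⟨
  staircase m + weight (tailSum m) L
    ∎
  where
  open ≡-Reasoning
  z = zeros L
  L′ = nonZeroPreds L
  y = fromParts L′
  s = sum (tail m)
  regroup : ∀ a z s t w → a * z + (s * z + (s * 1 + (t + w))) ≡ (s + t) + (z * (a + s) + w)
  regroup = solve-∀

fromParts-surjective : ∀ {r} {x : Fin r → ℕ} → Increasing x → ∃[ L ] (∀ i → fromParts L i ≡ x i)
fromParts-surjective {zero} _ = [] , λ ()
fromParts-surjective {suc r} {x} inc with fromParts-surjective {x = gaps} gaps-increasing
  where
  gaps : Fin r → ℕ
  gaps i = x (suc i) ∸ suc (x zero)
  gaps-increasing : Increasing gaps
  gaps-increasing i j i<j = ∸-monoˡ-< (inc (suc i) (suc j) (s≤s i<j)) (inc zero (suc i) z<s)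
... | L′ , eq = replicate (x zero) zero ++ map suc L′ , entries
  where
  L = replicate (x zero) zero ++ map suc L′
  entries : ∀ i → fromParts L i ≡ x i
  entries zero = zeros-replicate (x zero) L′
  entries (suc i) = begin
    zeros L + suc (fromParts (nonZeroPreds L) i)   ≡⟨ cong₂ (λ a b → a + suc (fromParts b i)) (zeros-replicate (x zero) L′) (nonZeroPreds-replicate (x zero) L′) ⟩
    x zero + suc (fromParts L′ i)                  ≡⟨ +-suc (x zero) _ ⟩
    suc (x zero) + fromParts L′ i                  ≡⟨ cong (suc (x zero) +_) (eq i) ⟩
    suc (x zero) + (x (suc i) ∸ suc (x zero))      ≡⟨ m+[n∸m]≡n (inc zero (suc i) z<s) ⟩
    x (suc i)                                      ∎
    where open ≡-Reasoning

solution-parts : ∀ {r} (m : Fin r → ℕ) {f x} → GeneralSolution m f x →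
  ∃[ L ] staircase m + weight (tailSum m) L ≡ f
solution-parts m (inc , sum-x) with fromParts-surjective inc
... | L , eq = L , trans (sym (sum-fromParts m L)) (trans (sum-cong-≗ (λ i → cong (m i *_) (eq i))) sum-x)

parts-solution : ∀ {r} (m : Fin r → ℕ) (L : List (Fin r)) → GeneralSolution m (staircase m + weight (tailSum m) L) (fromParts L)
parts-solution m L = fromParts-increasing L , sum-fromParts m L

take-+ : {A : Set} (i s : ℕ) (xs : List A) → take (i + s) xs ≡ take i xs ++ take s (drop i xs)
take-+ zero s xs = refl
take-+ (suc i) s [] = sym (take-[] s)
take-+ (suc i) s (x ∷ xs) = cong (x ∷_) (take-+ i s xs)

[m+n]%o≡m%o⇒o∣n : ∀ m n o .{{_ : NonZero o}} → (m + n) % o ≡ m % o → o ∣ n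
[m+n]%o≡m%o⇒o∣n m n o same = divides ((m + n) / o ∸ m / o) (begin
  n                                                   ≡⟨ m+n∸m≡n m n ⟨
  m + n ∸ m                                           ≡⟨ cong₂ _∸_ (m≡m%n+[m/n]*n (m + n) o) (m≡m%n+[m/n]*n m o) ⟩
  (m + n) % o + (m + n) / o * o ∸ (m % o + m / o * o) ≡⟨ cong (λ t → t + (m + n) / o * o ∸ (m % o + m / o * o)) same ⟩
  m % o + (m + n) / o * o ∸ (m % o + m / o * o)       ≡⟨ [m+n]∸[m+o]≡n∸o (m % o) _ _ ⟩
  (m + n) / o * o ∸ m / o * o                         ≡⟨ *-distribʳ-∸ o ((m + n) / o) (m / o) ⟨
  ((m + n) / o ∸ m / o) * o                           ∎)
  where open ≡-Reasoning

-- Two of the P + 1 prefix weights take(0), …, take(P) agree modulo P; the block between them works.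
divisible-block : {A : Set} (g : A → ℕ) (P : ℕ) .{{_ : NonZero P}} (xs : List A) → P ≤ length xs →
  ∃[ a ] ∃[ b ] ∃[ d ] xs ≡ a ++ b ++ d × 0 < length b × P ∣ weight g b
divisible-block g P xs P≤∣xs∣ = block (FinP.pigeonhole (n<1+n P) residue)
  where
  residue : Fin (suc P) → Fin P
  residue i = fromℕ< (m%n<n (weight g (take (toℕ i) xs)) P)
  block : ∃[ i ] ∃[ j ] i F.< j × residue i ≡ residue j →
    ∃[ a ] ∃[ b ] ∃[ d ] xs ≡ a ++ b ++ d × 0 < length b × P ∣ weight g b
  block (i , j , i<j , same) = take I xs , b , drop s (drop I xs) , split , nonempty , divisible
    where
    I = toℕ i
    s = toℕ j ∸ I
    b = take s (drop I xs)
    split : xs ≡ take I xs ++ b ++ drop s (drop I xs)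
    split = sym (trans (cong (take I xs ++_) (take++drop≡id s (drop I xs))) (take++drop≡id I xs))
    s≤rest : s ≤ length (drop I xs)
    s≤rest = subst (s ≤_) (sym (length-drop I xs)) (∸-monoˡ-≤ I (≤-trans (FinP.toℕ≤pred[n] j) P≤∣xs∣))
    nonempty : 0 < length b
    nonempty = subst (0 <_) (sym (trans (length-take s (drop I xs)) (m≤n⇒m⊓n≡m s≤rest))) (m<n⇒0<n∸m i<j)
    prefix-j : weight g (take (toℕ j) xs) ≡ weight g (take I xs) + weight g b
    prefix-j = trans (cong (λ t → weight g (take t xs)) (sym (m+[n∸m]≡n (<⇒≤ i<j))))
                     (trans (cong (weight g) (take-+ I s xs)) (weight-++ g (take I xs) b))
    divisible : P ∣ weight g b
    divisible = [m+n]%o≡m%o⇒o∣n (weight g (take I xs)) (weight g b) P (begin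
      (weight g (take I xs) + weight g b) % P ≡⟨ cong (_% P) prefix-j ⟨
      weight g (take (toℕ j) xs) % P          ≡⟨ FinP.toℕ-fromℕ< _ ⟨
      toℕ (residue j)                         ≡⟨ cong toℕ same ⟨
      toℕ (residue i)                         ≡⟨ FinP.toℕ-fromℕ< _ ⟩
      weight g (take I xs) % P                ∎)
      where open ≡-Reasoning

-- Normal forms of part lists

record Normalised {I : Set} (w : I → ℕ) (p P : ℕ) (xs : List I) : Set where
  field
    copies : ℕ
    rest : List I
    rest-small : All (λ x → w x < p) rest
    rest-short : length rest < P
    weight-split : weight w xs ≡ copies * p + weight w rest

  size : ℕ
  size = copies + length rest

collect : ∀ q q′ p w → q * p + (q′ * p + w) ≡ (q + q′) * p + w
collect = solve-∀

module _ {I : Set} (w : I → ℕ) {p : ℕ} where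

  split-full : (∀ x → w x ≤ p) → ∀ xs →
    ∃[ q ] ∃[ ys ] All (λ x → w x < p) ys × length ys ≤ length xs × weight w xs ≡ q * p + weight w ys
  split-full w≤p [] = 0 , [] , [] , z≤n , refl
  split-full w≤p (x ∷ xs) with split-full w≤p xs | m≤n⇒m<n∨m≡n (w≤p x)
  ... | q , ys , small , shorter , eq | inj₁ w<p =
    q , x ∷ ys , w<p ∷ small , s≤s shorter ,
    trans (cong (w x +_) eq) (x∙yz≈y∙xz (w x) (q * p) (weight w ys))
  ... | q , ys , small , shorter , eq | inj₂ w≡p =
    suc q , ys , small , m≤n⇒m≤1+n shorter , trans (cong₂ _+_ w≡p eq) (sym (+-assoc p (q * p) (weight w ys)))

  module _ {c P : ℕ} .{{_ : NonZero P}} (p≡P*c : p ≡ P * c) (c∣w : ∀ x → c ∣ w x) where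

    quotient : I → ℕ
    quotient x = _∣_.quotient (c∣w x)

    remove-block : ∀ xs → P ≤ length xs → ∃[ t ] ∃[ ys ] length ys < length xs × weight w xs ≡ t * p + weight w ys
    remove-block xs P≤∣xs∣ with divisible-block quotient P xs P≤∣xs∣
    ... | a , b , d , refl , nonempty , divides t block≡tP = t , a ++ d , shorter , reweigh
      where
      open ≡-Reasoning
      shorter : length (a ++ d) < length (a ++ b ++ d)
      shorter = subst₂ _<_ (sym (length-++ a)) (sym (trans (length-++ a) (cong (length a +_) (length-++ b))))
                       (+-monoʳ-< (length a) (m<n+m (length d) nonempty))
      block-weight : weight w b ≡ t * p
      block-weight = begin
        weight w b            ≡⟨ weight-* w quotient c (λ x → _∣_.equality (c∣w x)) b ⟩
        weight quotient b * c ≡⟨ cong (_* c) block≡tP ⟩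
        t * P * c             ≡⟨ *-assoc t P c ⟩
        t * (P * c)           ≡⟨ cong (t *_) p≡P*c ⟨
        t * p                 ∎
      reweigh : weight w (a ++ b ++ d) ≡ t * p + weight w (a ++ d)
      reweigh = begin
        weight w (a ++ b ++ d)                  ≡⟨ weight-++ w a (b ++ d) ⟩
        weight w a + weight w (b ++ d)          ≡⟨ cong (weight w a +_) (weight-++ w b d) ⟩
        weight w a + (weight w b + weight w d)  ≡⟨ x∙yz≈y∙xz (weight w a) (weight w b) (weight w d) ⟩
        weight w b + (weight w a + weight w d)  ≡⟨ cong₂ _+_ block-weight (sym (weight-++ w a d)) ⟩
        t * p + weight w (a ++ d)               ∎

    shorten : ∀ xs → ∃[ q ] ∃[ ys ] length ys < P × weight w xs ≡ q * p + weight w ys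
    shorten xs = go xs (<-wellFounded (length xs))
      where
      go : ∀ xs → Acc _<_ (length xs) → ∃[ q ] ∃[ ys ] length ys < P × weight w xs ≡ q * p + weight w ys
      go xs (acc rec) with length xs <? P
      ... | yes short = 0 , xs , short , refl
      ... | no long with remove-block xs (≮⇒≥ long)
      ... | t , ys , shorter , eq with go ys (rec shorter)
      ... | q , zs , short , eq′ = t + q , zs , short , trans eq (trans (cong (t * p +_) eq′) (collect t q p (weight w zs)))

    normalise : (∀ x → w x ≤ p) → ∀ xs → Normalised w p P xs
    normalise w≤p xs with shorten xs
    ... | q , ys , short , eq with split-full w≤p ys
    ... | q′ , zs , small , shorter , eq′ = record
      { copies = q + q′
      ; rest = zs
      ; rest-small = small
      ; rest-short = ≤-<-trans shorter short
      ; weight-split = trans eq (trans (cong (q * p +_) eq′) (collect q q′ p (weight w zs)))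
      }

module _ {I J : Set} {wI : I → ℕ} {wJ : J → ℕ} {p P K : ℕ} {A : List I} {B : List J} where

  some-normal-form-fits : 2 * P < K + 4 → 0 < p → (NA : Normalised wI p P A) (NB : Normalised wJ p P B) →
    weight wI A + weight wJ B ≡ K * p → Normalised.size NA ≤ K ⊎ Normalised.size NB ≤ K
  some-normal-form-fits slack p>0 NA NB total with Normalised.size NA ≤? K | Normalised.size NB ≤? K
  ... | yes fits | _ = inj₁ fits
  ... | no _ | yes fits = inj₂ fits
  ... | no A-long | no B-long = ⊥-elim (<⇒≱ slack too-many)
    where
    open ≤-Reasoning
    open Normalised NA using () renaming (copies to a; rest to RA; rest-short to RA-short; weight-split to A-split)
    open Normalised NB using () renaming (copies to b; rest to RB; rest-short to RB-short; weight-split to B-split)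
    copies-fit : a + b ≤ K
    copies-fit = *-cancelʳ-≤ (a + b) K p {{>-nonZero p>0}} (begin
      (a + b) * p                                     ≡⟨ *-distribʳ-+ p a b ⟩
      a * p + b * p                                   ≤⟨ +-mono-≤ (m≤m+n (a * p) _) (m≤m+n (b * p) _) ⟩
      (a * p + weight wI RA) + (b * p + weight wJ RB) ≡⟨ cong₂ _+_ A-split B-split ⟨
      weight wI A + weight wJ B                       ≡⟨ total ⟩
      K * p                                           ∎)
    rests-long : K + 2 ≤ length RA + length RB
    rests-long = +-cancelˡ-≤ K _ _ (begin
      K + (K + 2)                               ≡⟨ x+[x+2]≡1+x+[1+x] K ⟩
      suc K + suc K                             ≤⟨ +-mono-≤ (≰⇒> A-long) (≰⇒> B-long) ⟩
      (a + length RA) + (b + length RB)         ≡⟨ interchange a (length RA) b (length RB) ⟩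
      (a + b) + (length RA + length RB)         ≤⟨ +-monoˡ-≤ _ copies-fit ⟩
      K + (length RA + length RB)               ∎)
      where
      x+[x+2]≡1+x+[1+x] : ∀ x → x + (x + 2) ≡ suc x + suc x
      x+[x+2]≡1+x+[1+x] = solve-∀
    too-many : K + 4 ≤ 2 * P
    too-many = begin
      K + 4                             ≡⟨ +-assoc K 2 2 ⟨
      K + 2 + 2                         ≤⟨ +-monoˡ-≤ 2 rests-long ⟩
      length RA + length RB + 2         ≡⟨ x+y+2≡1+x+[1+y] (length RA) (length RB) ⟩
      suc (length RA) + suc (length RB) ≤⟨ +-mono-≤ RA-short RB-short ⟩
      P + P                             ≡⟨ cong (P +_) (+-identityʳ P) ⟨
      2 * P                             ∎
      where
      x+y+2≡1+x+[1+y] : ∀ x y → x + y + 2 ≡ suc x + suc y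
      x+y+2≡1+x+[1+y] = solve-∀

module _ {I : Set} {wI : I → ℕ} {p P K : ℕ} (top : I) (top≡p : wI top ≡ p) where

  parts-from-own-normal-form : ∀ {A} (NA : Normalised wI p P A) → Normalised.size NA ≤ K →
    ∃[ L ] length L ≤ K × weight wI L ≡ weight wI A
  parts-from-own-normal-form {A} NA fits =
    replicate a top ++ RA ,
    subst (_≤ K) (sym (trans (length-++ (replicate a top)) (cong (_+ length RA) (length-replicate a)))) fits ,
    (begin
      weight wI (replicate a top ++ RA)          ≡⟨ weight-++ wI (replicate a top) RA ⟩
      weight wI (replicate a top) + weight wI RA ≡⟨ cong (_+ weight wI RA) (weight-replicate wI a top) ⟩
      a * wI top + weight wI RA                  ≡⟨ cong (λ t → a * t + weight wI RA) top≡p ⟩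
      a * p + weight wI RA                       ≡⟨ A-split ⟨
      weight wI A                                ∎)
    where
    open ≡-Reasoning
    open Normalised NA using () renaming (copies to a; rest to RA; weight-split to A-split)

  module _ {J : Set} {wJ : J → ℕ} (complement : ∀ j → wJ j < p → ∃[ i ] wI i + wJ j ≡ p) where

    complements : ∀ S → All (λ j → wJ j < p) S → ∃[ L ] length L ≡ length S × weight wI L + weight wJ S ≡ length S * p
    complements [] [] = [] , refl , refl
    complements (j ∷ S) (small ∷ smalls) with complement j small | complements S smalls
    ... | i , i+j≡p | L , same-length , L+S≡ = i ∷ L , cong suc same-length , (begin
      wI i + weight wI L + (wJ j + weight wJ S)   ≡⟨ interchange (wI i) (weight wI L) (wJ j) (weight wJ S) ⟩
      (wI i + wJ j) + (weight wI L + weight wJ S) ≡⟨ cong₂ _+_ i+j≡p L+S≡ ⟩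
      p + length S * p                            ∎)
      where open ≡-Reasoning

    parts-from-complementary-normal-form : ∀ {A B} (NB : Normalised wJ p P B) → Normalised.size NB ≤ K →
      weight wI A + weight wJ B ≡ K * p → ∃[ L ] length L ≤ K × weight wI L ≡ weight wI A
    parts-from-complementary-normal-form {A} {B} NB fits total
      with complements (Normalised.rest NB) (Normalised.rest-small NB)
    ... | L′ , same-length , L′+RB≡ = replicate Z top ++ L′ , length-fits , weight-same
      where
      open Normalised NB using () renaming (copies to b; rest to RB; weight-split to B-split)
      Z = K ∸ Normalised.size NB
      Z+size≡K : Z + (b + length RB) ≡ K
      Z+size≡K = m∸n+n≡m fits
      length-fits : length (replicate Z top ++ L′) ≤ K
      length-fits = begin
        length (replicate Z top ++ L′)       ≡⟨ length-++ (replicate Z top) ⟩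
        length (replicate Z top) + length L′ ≡⟨ cong₂ _+_ (length-replicate Z) same-length ⟩
        Z + length RB                        ≤⟨ +-monoʳ-≤ Z (m≤n+m (length RB) b) ⟩
        Z + (b + length RB)                  ≡⟨ Z+size≡K ⟩
        K                                    ∎
        where open ≤-Reasoning
      weight-same : weight wI (replicate Z top ++ L′) ≡ weight wI A
      weight-same = +-cancelʳ-≡ (weight wJ B) _ _ (begin
        weight wI (replicate Z top ++ L′) + weight wJ B
          ≡⟨ cong₂ _+_ (weight-++ wI (replicate Z top) L′) B-split ⟩
        (weight wI (replicate Z top) + weight wI L′) + (b * p + weight wJ RB)
          ≡⟨ cong (λ t → (t + weight wI L′) + (b * p + weight wJ RB)) (trans (weight-replicate wI Z top) (cong (Z *_) top≡p)) ⟩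
        (Z * p + weight wI L′) + (b * p + weight wJ RB)
          ≡⟨ interchange (Z * p) (weight wI L′) (b * p) (weight wJ RB) ⟩
        (Z * p + b * p) + (weight wI L′ + weight wJ RB)
          ≡⟨ cong ((Z * p + b * p) +_) L′+RB≡ ⟩
        (Z * p + b * p) + length RB * p
          ≡⟨ collect-copies Z b (length RB) p ⟩
        (Z + (b + length RB)) * p
          ≡⟨ cong (_* p) Z+size≡K ⟩
        K * p
          ≡⟨ total ⟨
        weight wI A + weight wJ B
          ∎)
        where
        open ≡-Reasoning
        collect-copies : ∀ x y z p → (x * p + y * p) + z * p ≡ (x + (y + z)) * p
        collect-copies = solve-∀

few-parts : ∀ {I J : Set} {wI : I → ℕ} {wJ : J → ℕ} {p P K : ℕ} (top : I) → wI top ≡ p →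
  (∀ j → wJ j < p → ∃[ i ] wI i + wJ j ≡ p) → 2 * P < K + 4 → 0 < p →
  ∀ {A B} → Normalised wI p P A → Normalised wJ p P B → weight wI A + weight wJ B ≡ K * p →
  ∃[ L ] length L ≤ K × weight wI L ≡ weight wI A
few-parts top top≡p complement slack p>0 {A} NA NB total with some-normal-form-fits slack p>0 NA NB total
... | inj₁ fits = parts-from-own-normal-form top top≡p NA fits
... | inj₂ fits = parts-from-complementary-normal-form top top≡p complement {A} NB fits total

opposite-< : ∀ {r} {i j : Fin r} → i F.< j → opposite j F.< opposite i
opposite-< {suc n} {i} {j} i<j rewrite FinP.opposite-prop i | FinP.opposite-prop j =
  ∸-monoʳ-< (s≤s i<j) (s≤s (FinP.toℕ≤pred[n] j))

increasing-≤-last : ∀ {n} {x : Fin (suc n) → ℕ} → Increasing x → ∀ i → x i ≤ x (fromℕ n)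
increasing-≤-last {n} inc i with i F.≟ fromℕ n
... | yes refl = ≤-refl
... | no i≢last = <⇒≤ (inc i (fromℕ n) (FinP.≤∧≢⇒< (FinP.≤fromℕ i) i≢last))

reverse-solution : ∀ {n} (m : Mult (suc n)) {k f} {x : Fin (suc n) → ℕ} →
  GeneralSolution m f x → HeightBound k x →
  GeneralSolution (reverseSeq m) (len m * k ∸ f) (λ i → k ∸ x (opposite i))
reverse-solution m {k} {f} {x} (inc , sum-x) x-last≤k = decreasing , sum-complement
  where
  x≤k : ∀ i → x i ≤ k
  x≤k i = ≤-trans (increasing-≤-last inc i) x-last≤k
  decreasing : Increasing (λ i → k ∸ x (opposite i))
  decreasing i j i<j = ∸-monoʳ-< (inc _ _ (opposite-< i<j)) (x≤k (opposite i))
  complement+f : sum (λ i → m i * (k ∸ x i)) + f ≡ len m * k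
  complement+f = begin
    sum (λ i → m i * (k ∸ x i)) + f                         ≡⟨ cong (_ +_) sum-x ⟨
    sum (λ i → m i * (k ∸ x i)) + sum (λ i → m i * x i)     ≡⟨ ∑-distrib-+ (λ i → m i * (k ∸ x i)) (λ i → m i * x i) ⟨
    sum (λ i → m i * (k ∸ x i) + m i * x i)                 ≡⟨ sum-cong-≗ (λ i → *-distribˡ-+ (m i) (k ∸ x i) (x i)) ⟨
    sum (λ i → m i * (k ∸ x i + x i))                       ≡⟨ sum-cong-≗ (λ i → cong (m i *_) (m∸n+n≡m (x≤k i))) ⟩
    sum (λ i → m i * k)                                     ≡⟨ *-distribʳ-sum k m ⟨
    len m * k                                               ∎
    where open ≡-Reasoning
  sum-complement : sum (λ i → m (opposite i) * (k ∸ x (opposite i))) ≡ len m * k ∸ f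
  sum-complement = begin
    sum (λ i → m (opposite i) * (k ∸ x (opposite i))) ≡⟨ sum-reverse (λ i → m i * (k ∸ x i)) ⟩
    sum (λ i → m i * (k ∸ x i))                       ≡⟨ m+n∸n≡m _ f ⟨
    sum (λ i → m i * (k ∸ x i)) + f ∸ f               ≡⟨ cong (_∸ f) complement+f ⟩
    len m * k ∸ f                                     ∎
    where open ≡-Reasoning

gcdAll-∣ : ∀ {r} (m : Fin r → ℕ) i → gcdAll m ∣ m i
gcdAll-∣ m zero = gcd[m,n]∣m (m zero) _
gcdAll-∣ m (suc i) = ∣-trans (gcd[m,n]∣n (m zero) _) (gcdAll-∣ (tail m) i)

gcdAll-positive : ∀ {n} (m : Mult (suc n)) → IsSortingSeq m → 0 < gcdAll m
gcdAll-positive m valid = n≢0⇒n>0 (λ c≡0 → <⇒≢ (valid zero) (sym (gcd[m,n]≡0⇒m≡0 c≡0)))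

ends-excess : ∀ {n} (m : Fin (suc (suc n)) → ℕ) →
  4 * sum m ∸ 2 * m zero ∸ 2 * last m ≡ 2 * sum m + 2 * sum (init (tail m))
ends-excess m = subst (λ p → 4 * p ∸ 2 * a ∸ 2 * b ≡ 2 * p + 2 * mid) (sym (cong (a +_) (sum-init-last (tail m)))) (excess a mid b)
  where
  a = m zero
  b = last m
  mid = sum (init (tail m))
  excess : ∀ a mid b → 4 * (a + (mid + b)) ∸ 2 * a ∸ 2 * b ≡ 2 * (a + (mid + b)) + 2 * mid
  excess a mid b = trans (∸-+-assoc (4 * (a + (mid + b))) (2 * a) (2 * b))
    (trans (cong (_∸ (2 * a + 2 * b)) (regroup a mid b)) (m+n∸m≡n (2 * a + 2 * b) _))
    where
    regroup : ∀ a mid b → 4 * (a + (mid + b)) ≡ (2 * a + 2 * b) + (2 * (a + (mid + b)) + 2 * mid)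
    regroup = solve-∀

slack-from-hypothesis : ∀ {n} (m : Mult (suc (suc n))) {c P k} .{{_ : NonZero c}} →
  len m ≡ P * c → (∀ i → c ≤ m i) → 0 < P →
  c * (k + suc (suc n)) ≥ (4 * len m ∸ 2 * m zero ∸ 2 * m (fromℕ (suc n))) + c →
  suc n ≤ k × 2 * P < k ∸ suc n + 4
slack-from-hypothesis {n} m {c} {P} {k} p≡P*c c≤m P>0 hypothesis = r-1≤k , slack
  where
  open ≤-Reasoning
  p = len m
  mid-large : n * c ≤ sum (init (tail m))
  mid-large = sum-≥ (init (tail m)) (λ i → c≤m (suc (inject₁ i)))
  scaled : c * ((2 * P + n) + suc n) ≤ c * ((k + 1) + suc n)
  scaled = begin
    c * ((2 * P + n) + suc n)             ≡⟨ expand c P n ⟩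
    2 * (P * c) + 2 * (n * c) + c         ≡⟨ cong (λ t → 2 * t + 2 * (n * c) + c) p≡P*c ⟨
    2 * p + 2 * (n * c) + c               ≤⟨ +-monoˡ-≤ c (+-monoʳ-≤ (2 * p) (*-monoʳ-≤ 2 mid-large)) ⟩
    2 * p + 2 * sum (init (tail m)) + c   ≡⟨ cong (_+ c) (ends-excess m) ⟨
    (4 * p ∸ 2 * m zero ∸ 2 * last m) + c ≤⟨ hypothesis ⟩
    c * (k + suc (suc n))                 ≡⟨ cong (c *_) (shuffle k n) ⟩
    c * ((k + 1) + suc n)                 ∎
    where
    expand : ∀ c P n → c * ((2 * P + n) + suc n) ≡ 2 * (P * c) + 2 * (n * c) + c
    expand = solve-∀
    shuffle : ∀ k n → k + suc (suc n) ≡ (k + 1) + suc n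
    shuffle = solve-∀
  2P+n≤k+1 : 2 * P + n ≤ k + 1
  2P+n≤k+1 = +-cancelʳ-≤ (suc n) _ _ (*-cancelˡ-≤ c scaled)
  r-1≤k : suc n ≤ k
  r-1≤k = +-cancelʳ-≤ 1 (suc n) k (begin
    suc n + 1     ≡⟨ +-comm (suc n) 1 ⟩
    2 * 1 + n     ≤⟨ +-monoˡ-≤ n (*-monoʳ-≤ 2 P>0) ⟩
    2 * P + n     ≤⟨ 2P+n≤k+1 ⟩
    k + 1         ∎)
  K = k ∸ suc n
  slack : 2 * P < K + 4
  slack = ≤-<-trans (+-cancelʳ-≤ (suc n) (2 * P) (K + 2) (begin
    2 * P + suc n       ≡⟨ +-suc (2 * P) n ⟩
    suc (2 * P + n)     ≤⟨ s≤s 2P+n≤k+1 ⟩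
    suc (k + 1)         ≡⟨ cong (λ t → suc (t + 1)) (m+[n∸m]≡n r-1≤k) ⟨
    suc (suc n + K + 1) ≡⟨ shuffle n K ⟩
    K + 2 + suc n       ∎)) (+-monoʳ-< K (s≤s (s≤s (s≤s z≤n))))
    where
    shuffle : ∀ n K → suc (suc n + K + 1) ≡ K + 2 + suc n
    shuffle = solve-∀

short-part-list : ∀ {n} (m : Mult (suc (suc n))) → IsSortingSeq m →
  ∀ {c P} .{{_ : NonZero P}} → len m ≡ P * c → (∀ i → c ∣ m i) →
  ∀ {k f A B} → suc n ≤ k → 2 * P < k ∸ suc n + 4 →
  staircase m + weight (tailSum m) A ≡ f →
  staircase (reverseSeq m) + weight (tailSum (reverseSeq m)) B ≡ len m * k ∸ f →
  ∃[ L ] length L ≤ k ∸ suc n × weight (tailSum m) L ≡ weight (tailSum m) A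
short-part-list {n} m valid p≡P*c c∣m {k} {f} {A} {B} r-1≤k slack A-count B-count =
  few-parts zero refl complement slack p>0
    (normalise (tailSum m) p≡P*c (tailSum-∣ m c∣m) (tailSum-≤ m) A)
    (normalise (tailSum (reverseSeq m)) p≡P*c (tailSum-∣ (reverseSeq m) (c∣m ∘ opposite)) reverse-tailSum-≤ B)
    total
  where
  p = len m
  K = k ∸ suc n
  WA = weight (tailSum m) A
  WB = weight (tailSum (reverseSeq m)) B
  p>0 : 0 < p
  p>0 = ≤-trans (valid zero) (m≤m+n (m zero) _)
  reverse-tailSum-≤ : ∀ j → tailSum (reverseSeq m) j ≤ p
  reverse-tailSum-≤ j = subst (tailSum (reverseSeq m) j ≤_) (sum-reverse m) (tailSum-≤ (reverseSeq m) j)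
  complement : ∀ j → tailSum (reverseSeq m) j < p → ∃[ i ] tailSum m i + tailSum (reverseSeq m) j ≡ p
  complement j small with tailSum-reverse m j
  ... | inj₁ whole = ⊥-elim (<⇒≢ small whole)
  ... | inj₂ complementary = complementary
  -- pk ∸ f is truncated; it is the count of a solution for S′, which is positive.
  f≤pk : f ≤ p * k
  f≤pk with f ≤? p * k
  ... | yes f≤pk = f≤pk
  ... | no f≰pk = ⊥-elim (<⇒≢ (≤-trans (staircase-positive (reverseSeq m) (valid ∘ opposite)) (m≤m+n _ WB))
                              (sym (trans B-count (m≤n⇒m∸n≡0 (<⇒≤ (≰⇒> f≰pk))))))
  total : WA + WB ≡ K * p
  total = +-cancelˡ-≡ (p * suc n) _ _ (begin
    p * suc n + (WA + WB)                                       ≡⟨ cong (_+ (WA + WB)) (staircase-reverse m) ⟨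
    (staircase m + staircase (reverseSeq m)) + (WA + WB)        ≡⟨ interchange (staircase m) (staircase (reverseSeq m)) WA WB ⟩
    (staircase m + WA) + (staircase (reverseSeq m) + WB)        ≡⟨ cong₂ _+_ A-count B-count ⟩
    f + (p * k ∸ f)                                             ≡⟨ m+[n∸m]≡n f≤pk ⟩
    p * k                                                       ≡⟨ cong (p *_) (m+[n∸m]≡n r-1≤k) ⟨
    p * (suc n + K)                                             ≡⟨ distrib p (suc n) K ⟩
    p * suc n + K * p                                           ∎)
    where
    open ≡-Reasoning
    distrib : ∀ p x y → p * (x + y) ≡ p * x + y * p
    distrib = solve-∀

bounded-solution : ∀ {n} (m : Mult (suc (suc n))) → IsSortingSeq m →
  ∀ {c P} .{{_ : NonZero P}} → len m ≡ P * c → (∀ i → c ∣ m i) →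
  ∀ {k f x y} → suc n ≤ k → 2 * P < k ∸ suc n + 4 →
  GeneralSolution m f x → GeneralSolution (reverseSeq m) (len m * k ∸ f) y →
  ∃[ x′ ] GeneralSolution m f x′ × HeightBound k x′
bounded-solution {n} m valid p≡P*c c∣m {k} r-1≤k slack solution solution′ =
  let A , A-count = solution-parts m solution
      B , B-count = solution-parts (reverseSeq m) solution′
      L , few , same-weight = short-part-list m valid p≡P*c c∣m {A = A} {B = B} r-1≤k slack A-count B-count
  in fromParts L ,
     subst (λ t → GeneralSolution m t (fromParts L)) (trans (cong (staircase m +_) same-weight) A-count) (parts-solution m L) ,
     (begin
       fromParts L (fromℕ (suc n)) ≡⟨ fromParts-last L ⟩
       suc n + length L            ≤⟨ +-monoʳ-≤ (suc n) few ⟩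
       suc n + (k ∸ suc n)         ≡⟨ m+[n∸m]≡n r-1≤k ⟩
       k                           ∎)
  where open ≤-Reasoning

mainTheorem5 : (n : ℕ) → (m : Mult (suc n)) → IsSortingSeq m → 1 < suc n →
    (k f : ℕ) →
    gcdAll m * (k + suc n) ≥ (4 * len m ∸ 2 * m zero ∸ 2 * m (fromℕ n)) + gcdAll m →
    Σ (Fin (suc n) → ℕ) (λ fs → GeneralSolution m f fs) →
    Σ (Fin (suc n) → ℕ) (λ gs → GeneralSolution (reverseSeq m) (len m * k ∸ f) gs) →
    Σ (Fin (suc n) → ℕ) (λ fs → GeneralSolution m f fs × HeightBound k fs)
      × Σ (Fin (suc n) → ℕ) (λ gs → GeneralSolution (reverseSeq m) (len m * k ∸ f) gs × HeightBound k gs)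
mainTheorem5 zero m valid (s≤s ()) k f hypothesis solution solution′
mainTheorem5 (suc n) m valid _ k f hypothesis (_ , solution) (_ , solution′) =
  let r-1≤k , slack = slack-from-hypothesis m p≡P*c c≤m P>0 hypothesis
      x′ , solution-x′ , bounded-x′ = bounded-solution m valid p≡P*c (gcdAll-∣ m) r-1≤k slack solution solution′
  in (x′ , solution-x′ , bounded-x′) ,
     ((λ i → k ∸ x′ (opposite i)) , reverse-solution m solution-x′ bounded-x′ , m∸n≤m k (x′ (opposite (fromℕ (suc n)))))
  where
  c = gcdAll m
  instance
    c≢0 : NonZero c
    c≢0 = >-nonZero (gcdAll-positive m valid)
  c≤m : ∀ i → c ≤ m i
  c≤m i = ∣⇒≤ {{>-nonZero (valid i)}} (gcdAll-∣ m i)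
  P = len m / c
  p≡P*c : len m ≡ P * c
  p≡P*c = sym (m/n*n≡m (sum-∣ m (gcdAll-∣ m)))
  P>0 : 0 < P
  P>0 = m≥n⇒m/n>0 (≤-trans (c≤m zero) (m≤m+n (m zero) _))
  instance
    P≢0 : NonZero P
    P≢0 = >-nonZero P>0
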